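{- Let $r\in\mathbb{N}^+$, $S\subseteq\{0,\dots,r\}$, and $\Gamma=\mathrm{SymLang\text{ - }N}(r,S)$. If $\Gamma$ is nontrivial and bijunctive, then $\Gamma$ is (equivalent to) either $\le1\text{ -out-of- }r\mathrm{SAT}$, $r\mathrm{AE}$, or $r\mathrm{AND}$.
   Context: For $R\subseteq\{0,1\}^r$ and $b\in\mathbb{F}_2^r$, $R\oplus b=\{\alpha\oplus b:\alpha\in R\}$; $\mathrm{SymRel}(r,S)=\{x\in\{0,1\}^r:\sum_i x_i\in S\}$; $\mathrm{SymLang\text{ - }N}(r,S)=\{\mathrm{SymRel}(r,S)\oplus b: b\in\mathbb{F}_2^r\}$. $r\mathrm{AND}=\mathrm{SymLang\text{ - }N}(r,\{0\})$, $r\mathrm{AE}=\mathrm{SymLang\text{ - }N}(r,\{0,r\})$, $\le1\text{ -out-of- }r\mathrm{SAT}=\mathrm{SymLang\text{ - }N}(r,\{0,1\})$. A language is trivial if it is $\varnothing$ or $\{\{0,1\}^r\}$; two languages are equivalent if they contain the same relations. A relation is bijunctive if it is expressible as a conjunction of clauses with 1 or 2 literals (negations allowed); a language is bijunctive if all its relations are. -}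

module Defs where

open import Level using (0ℓ) renaming (suc to lsuc)
open import Data.Nat using (ℕ; zero; suc; _≤_; _≡ᵇ_)
open import Data.Bool using (Bool; true; false; _xor_; not; T; _∨_)
open import Data.Fin using (Fin)
open import Data.Vec as Vec using (Vec; zipWith; lookup)
open import Data.List using (List)
open import Data.List.Relation.Unary.All using (All)
open import Data.Product using (Σ; ∃; _×_; _,_)
open import Data.Sum using (_⊎_)
open import Data.Empty using (⊥)
open import Data.Unit using (⊤)
open import Relation.Binary.PropositionalEquality using (_≡_)
open import Relation.Unary using (Pred; _≐_)
open import Function.Bundles using (_⇔_)

-- A point of {0,1}^r (0 = false, 1 = true), and relations R ⊆ {0,1}^r.
Point : ℕ → Set
Point r = Vec Bool r

Rel : ℕ → Set₁
Rel r = Pred (Point r) 0ℓ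

Lang : ℕ → Set₁
Lang r = Pred (Rel r) 0ℓ

weight : ∀ {r} → Point r → ℕ
weight Vec.[] = 0
weight (true Vec.∷ x) = suc (weight x)
weight (false Vec.∷ x) = weight x

_⊕ᵥ_ : ∀ {r} → Point r → Point r → Point r
a ⊕ᵥ b = zipWith _xor_ a b

_⊕_ : ∀ {r} → Rel r → Point r → Rel r
(R ⊕ b) x = ∃ λ α → R α × (x ≡ α ⊕ᵥ b)

-- A set S ⊆ ℕ is given by its (decidable) characteristic function.
NatSet : Set
NatSet = ℕ → Bool

SymRel : (r : ℕ) → NatSet → Rel r
SymRel r S x = T (S (weight x))

-- SymLang-N(r,S) = { SymRel(r,S) ⊕ b : b ∈ 𝔽₂^r }.
-- Relations are sets, so membership is up to extensional equality (≐).
SymLangN : (r : ℕ) → NatSet → Lang r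
SymLangN r S R = ∃ λ (b : Point r) → R ≐ (SymRel r S ⊕ b)

S-AND : ℕ → NatSet
S-AND r k = k ≡ᵇ 0

S-AE : ℕ → NatSet
S-AE r k = (k ≡ᵇ 0) ∨ (k ≡ᵇ r)

S-≤1 : ℕ → NatSet
S-≤1 r k = (k ≡ᵇ 0) ∨ (k ≡ᵇ 1)

rAND : (r : ℕ) → Lang r
rAND r = SymLangN r (S-AND r)

rAE : (r : ℕ) → Lang r
rAE r = SymLangN r (S-AE r)

≤1-out-of-SAT : (r : ℕ) → Lang r
≤1-out-of-SAT r = SymLangN r (S-≤1 r)

_≈L_ : ∀ {r} → Lang r → Lang r → Set₁
Γ ≈L Δ = ∀ R → (Γ R → ∃ λ R′ → Δ R′ × R ≐ R′) × (Δ R → ∃ λ R′ → Γ R′ × R ≐ R′)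

emptyRel : ∀ {r} → Rel r
emptyRel _ = ⊥

fullRel : ∀ {r} → Rel r
fullRel _ = ⊤

emptyLang : ∀ {r} → Lang r
emptyLang _ = ⊥

singletonLang : ∀ {r} → Rel r → Lang r
singletonLang R R′ = R′ ≐ R

Trivial : ∀ {r} → Lang r → Set₁
Trivial Γ = (Γ ≈L emptyLang) ⊎ (Γ ≈L singletonLang emptyRel) ⊎ (Γ ≈L singletonLang fullRel)

-- literals x_i / ¬x_i  (polarity true = positive literal)
record Literal (r : ℕ) : Set where
  constructor lit
  field
    var      : Fin r
    polarity : Bool

data Clause (r : ℕ) : Set where
  unit : Literal r → Clause r
  bin  : Literal r → Literal r → Clause r

satLit : ∀ {r} → Point r → Literal r → Set
satLit x (lit i p) = lookup x i ≡ p

satClause : ∀ {r} → Point r → Clause r → Set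
satClause x (unit l)    = satLit x l
satClause x (bin l₁ l₂) = satLit x l₁ ⊎ satLit x l₂

⟦_⟧ : ∀ {r} → List (Clause r) → Rel r
⟦ φ ⟧ x = All (satClause x) φ

BijunctiveRel : ∀ {r} → Rel r → Set
BijunctiveRel R = ∃ λ φ → R ≐ ⟦ φ ⟧

Bijunctive : ∀ {r} → Lang r → Set₁
Bijunctive Γ = ∀ R → Γ R → BijunctiveRel R

{-# OPTIONS --safe #-}
-- SymLangN(r,S) is the set of translates of SymRel(r,S), and every relation
-- in a bijunctive language is closed under the coordinatewise majority. For
-- r = 2 + m and any u, w ∈ {0,1}^m, the majority of 00u, 01w, 10w is 00w and
-- that of 11u, 10w, 01w is 11w. So, for c ≤ m: if S has an element ≤ m, then
-- c + 1 ∈ S gives c ∈ S; if S has an element ≥ 2, then c + 1 ∈ S gives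
-- c + 2 ∈ S. When both apply and some element lies in [1, r − 1], S ∩ [0, r]
-- is everything. For a nontrivial S and r ≥ 3 this rules out elements in
-- [2, r − 2] and the pairs {0, r − 1}, {1, r}, and 1 ∈ S forces 0 ∈ S,
-- r − 1 ∈ S forces r ∈ S. So up to the reflection k ↦ r − k (translation by
-- 1⋯1), S ∩ [0, r] is {0}, {0, 1} or {0, r}. For r ≤ 2 the few cases are
-- checked directly; the one exception, SymRel(2, {1}), is the translate of
-- SymRel(2, {0, 2}) by 10.
module Submission where

open import Defs
open import Data.Bool using (Bool; true; false; T)
open import Data.Bool.Properties using (T?; xor-assoc; xor-same; xor-identityʳ)
open import Data.Empty using (⊥-elim)
open import Data.List using (List)
open import Data.List.Relation.Unary.All using (zip; zipWith)
open import Data.Nat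
  using (ℕ; zero; suc; _+_; _∸_; _≤_; _<_; _≤′_; ≤′-refl; ≤′-step; z≤n; s≤s; _≡ᵇ_)
open import Data.Nat.Properties
  using ( ≤-refl; ≤-trans; ≤-total; <⇒≤; m≤n⇒m<n∨m≡n; n≤1+n; m≤n⇒m≤1+n; 1+n≰n; m∸n≤m
        ; m∸[m∸n]≡n; +-∸-assoc; ≡ᵇ⇒≡; ≡⇒≡ᵇ; ≤⇒≤′; ≤′⇒≤)
open import Data.Product using (Σ; ∃; _×_; _,_)
open import Data.Sum using (_⊎_; inj₁; inj₂)
import Data.Sum as Sum
open import Data.Unit using (tt)
open import Data.Vec using ([]; _∷_; replicate; lookup)
open import Data.Fin using (Fin)
open import Data.Vec.Properties using (zipWith-assoc; zipWith-identityʳ)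
open import Function using (_∘_; const)
open import Function.Bundles using (_⇔_; mk⇔; Equivalence)
open import Function.Construct.Identity using (⇔-id)
open import Relation.Binary.PropositionalEquality
  using (_≡_; refl; sym; trans; cong; cong₂; subst; module ≡-Reasoning)
open import Relation.Nullary using (¬_; yes; no)
open import Relation.Unary using (_≐_; _⊆_)
open import Relation.Unary.Properties using (≐-refl; ≐-sym; ≐-trans)

private
  variable
    r m n a b c j k : ℕ
    S G : NatSet

⇔-both : ∀ {A B : Set} → A → B → A ⇔ B
⇔-both x y = mk⇔ (const y) (const x)

⇔-neither : ∀ {A B : Set} → ¬ A → ¬ B → A ⇔ B
⇔-neither ¬x ¬y = mk⇔ (⊥-elim ∘ ¬x) (⊥-elim ∘ ¬y)

⊕ᵥ-assoc : (x y z : Point r) → (x ⊕ᵥ y) ⊕ᵥ z ≡ x ⊕ᵥ (y ⊕ᵥ z)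
⊕ᵥ-assoc = zipWith-assoc xor-assoc

⊕ᵥ-identityʳ : (x : Point r) → x ⊕ᵥ replicate r false ≡ x
⊕ᵥ-identityʳ = zipWith-identityʳ xor-identityʳ

⊕ᵥ-self : (x : Point r) → x ⊕ᵥ x ≡ replicate r false
⊕ᵥ-self []      = refl
⊕ᵥ-self (a ∷ x) = cong₂ _∷_ (xor-same a) (⊕ᵥ-self x)

⊕ᵥ-cancelʳ : (x y : Point r) → (x ⊕ᵥ y) ⊕ᵥ y ≡ x
⊕ᵥ-cancelʳ {r} x y = begin
  (x ⊕ᵥ y) ⊕ᵥ y          ≡⟨ ⊕ᵥ-assoc x y y ⟩
  x ⊕ᵥ (y ⊕ᵥ y)          ≡⟨ cong (x ⊕ᵥ_) (⊕ᵥ-self y) ⟩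
  x ⊕ᵥ replicate r false  ≡⟨ ⊕ᵥ-identityʳ x ⟩
  x                       ∎
  where open ≡-Reasoning

module _ {r : ℕ} where

  private
    variable
      R R₀ R₁ R₂ : Rel r
      x y : Point r

  ⊕⁺ : R (x ⊕ᵥ y) → (R ⊕ y) x
  ⊕⁺ {x = x} {y} Rx = x ⊕ᵥ y , Rx , sym (⊕ᵥ-cancelʳ x y)

  ⊕⁻ : (R ⊕ y) x → R (x ⊕ᵥ y)
  ⊕⁻ {R = R} {y} (α , Rα , refl) = subst R (sym (⊕ᵥ-cancelʳ α y)) Rα

  ⊕-cong : R₁ ≐ R₂ → R₁ ⊕ y ≐ R₂ ⊕ y
  ⊕-cong (R₁⊆R₂ , R₂⊆R₁) = (λ h → ⊕⁺ (R₁⊆R₂ (⊕⁻ h))) , (λ h → ⊕⁺ (R₂⊆R₁ (⊕⁻ h)))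

  ⊕-⊕ : (R ⊕ x) ⊕ y ≐ R ⊕ (y ⊕ᵥ x)
  ⊕-⊕ {R = R} {x} {y} =
    (λ {z} h → ⊕⁺ (subst R (⊕ᵥ-assoc z y x) (⊕⁻ (⊕⁻ h)))) ,
    (λ {z} h → ⊕⁺ (⊕⁺ (subst R (sym (⊕ᵥ-assoc z y x)) (⊕⁻ h))))

  ⊕-involutive : (R ⊕ y) ⊕ y ≐ R
  ⊕-involutive {R = R} {y} =
    (λ {z} h → subst R (⊕ᵥ-cancelʳ z y) (⊕⁻ (⊕⁻ h))) ,
    (λ {z} h → ⊕⁺ (⊕⁺ (subst R (sym (⊕ᵥ-cancelʳ z y)) h)))

  ⊕-identityʳ : R ⊕ replicate r false ≐ R
  ⊕-identityʳ {R = R} =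
    (λ {z} h → subst R (⊕ᵥ-identityʳ z) (⊕⁻ h)) ,
    (λ {z} h → ⊕⁺ (subst R (sym (⊕ᵥ-identityʳ z)) h))

  -- SymLangN r S is, by definition, Translates (SymRel r S).
  Translates : Rel r → Lang r
  Translates R₀ R = ∃ λ b → R ≐ R₀ ⊕ b

  ≐⇒translates : R ≐ R₀ → Translates R₀ R
  ≐⇒translates R≐R₀ = replicate r false , ≐-trans R≐R₀ (≐-sym ⊕-identityʳ)

  translates-sym : Translates R₀ R → Translates R R₀
  translates-sym (b , R≐R₀⊕b) = b , ≐-trans (≐-sym ⊕-involutive) (⊕-cong (≐-sym R≐R₀⊕b))

  translates-trans : Translates R₀ R₁ → Translates R₁ R₂ → Translates R₀ R₂
  translates-trans (b , R₁≐R₀⊕b) (c , R₂≐R₁⊕c) =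
    c ⊕ᵥ b , ≐-trans R₂≐R₁⊕c (≐-trans (⊕-cong R₁≐R₀⊕b) ⊕-⊕)

  ⊆×⊇⇒≈L : {Γ Δ : Lang r} → Γ ⊆ Δ → Δ ⊆ Γ → Γ ≈L Δ
  ⊆×⊇⇒≈L Γ⊆Δ Δ⊆Γ R = (λ h → R , Γ⊆Δ h , ≐-refl) , (λ h → R , Δ⊆Γ h , ≐-refl)

  translates-≈L : Translates R₀ R → Translates R ≈L Translates R₀
  translates-≈L t = ⊆×⊇⇒≈L (translates-trans t) (translates-trans (translates-sym t))

  translates-≈L-singleton : (∀ b → R ⊕ b ≐ R₀) → Translates R ≈L singletonLang R₀
  translates-≈L-singleton inv =
    ⊆×⊇⇒≈L (λ (b , R′≐R⊕b) → ≐-trans R′≐R⊕b (inv b))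
            (λ R′≐R₀ → replicate r false , ≐-trans R′≐R₀ (≐-sym (inv _)))

weight-≤ : (x : Point r) → weight x ≤ r
weight-≤ []          = z≤n
weight-≤ (true ∷ x)  = s≤s (weight-≤ x)
weight-≤ (false ∷ x) = m≤n⇒m≤1+n (weight-≤ x)

weight-complement : (x : Point r) → weight (x ⊕ᵥ replicate r true) ≡ r ∸ weight x
weight-complement []          = refl
weight-complement (true ∷ x)  = weight-complement x
weight-complement (false ∷ x) =
  trans (cong suc (weight-complement x)) (sym (+-∸-assoc 1 (weight-≤ x)))

pointOfWeight : j ≤ n → Σ (Point n) (λ w → weight w ≡ j)
pointOfWeight {n = zero}  z≤n = [] , refl
pointOfWeight {n = suc n} z≤n with pointOfWeight {n = n} z≤n
... | w , weight≡0 = false ∷ w , weight≡0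
pointOfWeight (s≤s j≤n) with pointOfWeight j≤n
... | w , weight≡j = true ∷ w , cong suc weight≡j

Agree : ℕ → NatSet → NatSet → Set
Agree r S G = ∀ k → k ≤ r → T (S k) ⇔ T (G k)

reflect : ℕ → NatSet → NatSet
reflect r S k = S (r ∸ k)

symRel-translates : (S G : NatSet) (c : Point r) →
                    (∀ x → T (S (weight x)) ⇔ T (G (weight (x ⊕ᵥ c)))) →
                    Translates (SymRel r G) (SymRel r S)
symRel-translates S G c S⇔G =
  c , (λ {x} h → ⊕⁺ (Equivalence.to (S⇔G x) h)) , (λ {x} h → Equivalence.from (S⇔G x) (⊕⁻ h))

agree⇒translates : (S G : NatSet) → Agree r S G → Translates (SymRel r G) (SymRel r S)
agree⇒translates S G S≈G =
  ≐⇒translates ( (λ {x} → Equivalence.to   (S≈G _ (weight-≤ x)))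
               , (λ {x} → Equivalence.from (S≈G _ (weight-≤ x))))

reflect-translates : (S : NatSet) → Translates (SymRel r S) (SymRel r (reflect r S))
reflect-translates {r} S = symRel-translates (reflect r S) S (replicate r true) complement
  where
  complement : ∀ x → T (S (r ∸ weight x)) ⇔ T (S (weight (x ⊕ᵥ replicate r true)))
  complement x rewrite weight-complement x = ⇔-id _

Full Empty : ℕ → NatSet → Set
Full r S  = ∀ k → k ≤ r → T (S k)
Empty r S = ∀ k → k ≤ r → ¬ T (S k)

reflect-full : (S : NatSet) → Full r (reflect r S) → Full r S
reflect-full {r} S full k k≤r = subst (T ∘ S) (m∸[m∸n]≡n k≤r) (full (r ∸ k) (m∸n≤m r k))

empty⇒trivial : (S : NatSet) → Empty r S → Trivial (SymLangN r S)
empty⇒trivial S empty = inj₂ (inj₁ (translates-≈L-singleton λ b →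
  (λ {x} h → empty _ (weight-≤ (x ⊕ᵥ b)) (⊕⁻ h)) , λ ()))

full⇒trivial : (S : NatSet) → Full r S → Trivial (SymLangN r S)
full⇒trivial S full = inj₂ (inj₂ (translates-≈L-singleton λ b →
  (λ _ → tt) , λ {x} _ → ⊕⁺ (full _ (weight-≤ (x ⊕ᵥ b)))))

maj : Bool → Bool → Bool → Bool
maj true  true  _ = true
maj false false _ = false
maj _     _     c = c

majority : Point r → Point r → Point r → Point r
majority []       []       []       = []
majority (a ∷ x) (b ∷ y) (c ∷ z) = maj a b c ∷ majority x y z

MajorityClosed : Rel r → Set
MajorityClosed R = ∀ x y z → R x → R y → R z → R (majority x y z)

AtLeastTwo : Set → Set → Set → Set
AtLeastTwo A B C = (A × B) ⊎ (A × C) ⊎ (B × C)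

atLeastTwo-pigeonhole : ∀ {A₁ A₂ B₁ B₂ C₁ C₂ : Set} → A₁ ⊎ A₂ → B₁ ⊎ B₂ → C₁ ⊎ C₂ →
                        AtLeastTwo A₁ B₁ C₁ ⊎ AtLeastTwo A₂ B₂ C₂
atLeastTwo-pigeonhole (inj₁ a) (inj₁ b) _        = inj₁ (inj₁ (a , b))
atLeastTwo-pigeonhole (inj₁ a) (inj₂ _) (inj₁ c) = inj₁ (inj₂ (inj₁ (a , c)))
atLeastTwo-pigeonhole (inj₁ _) (inj₂ b) (inj₂ c) = inj₂ (inj₂ (inj₂ (b , c)))
atLeastTwo-pigeonhole (inj₂ _) (inj₁ b) (inj₁ c) = inj₁ (inj₂ (inj₂ (b , c)))
atLeastTwo-pigeonhole (inj₂ a) (inj₁ _) (inj₂ c) = inj₂ (inj₂ (inj₁ (a , c)))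
atLeastTwo-pigeonhole (inj₂ a) (inj₂ b) _        = inj₂ (inj₁ (a , b))

maj-xxy : ∀ a c → maj a a c ≡ a
maj-xxy true  _ = refl
maj-xxy false _ = refl

maj-xyx : ∀ a b → maj a b a ≡ a
maj-xyx true  true  = refl
maj-xyx true  false = refl
maj-xyx false true  = refl
maj-xyx false false = refl

maj-xyy : ∀ a b → maj a b b ≡ b
maj-xyy true  true  = refl
maj-xyy true  false = refl
maj-xyy false true  = refl
maj-xyy false false = refl

maj-atLeastTwo : ∀ {a b c p} → AtLeastTwo (a ≡ p) (b ≡ p) (c ≡ p) → maj a b c ≡ p
maj-atLeastTwo (inj₁ (refl , refl))        = maj-xxy _ _
maj-atLeastTwo (inj₂ (inj₁ (refl , refl))) = maj-xyx _ _
maj-atLeastTwo (inj₂ (inj₂ (refl , refl))) = maj-xyy _ _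

lookup-majority : (x y z : Point r) (i : Fin r) →
                  lookup (majority x y z) i ≡ maj (lookup x i) (lookup y i) (lookup z i)
lookup-majority (_ ∷ _) (_ ∷ _) (_ ∷ _) Fin.zero    = refl
lookup-majority (_ ∷ x) (_ ∷ y) (_ ∷ z) (Fin.suc i) = lookup-majority x y z i

majority-xyy : (x y : Point r) → majority x y y ≡ y
majority-xyy []      []      = refl
majority-xyy (a ∷ x) (b ∷ y) = cong₂ _∷_ (maj-xyy a b) (majority-xyy x y)

satLit-majority : (x y z : Point r) (l : Literal r) →
                  AtLeastTwo (satLit x l) (satLit y l) (satLit z l) → satLit (majority x y z) l
satLit-majority x y z (lit i _) two = trans (lookup-majority x y z i) (maj-atLeastTwo two)

satClause-majority : (x y z : Point r) (cl : Clause r) →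
                     satClause x cl → satClause y cl → satClause z cl →
                     satClause (majority x y z) cl
satClause-majority x y z (unit l)    hx hy _  = satLit-majority x y z l (inj₁ (hx , hy))
satClause-majority x y z (bin l₁ l₂) hx hy hz =
  Sum.map (satLit-majority x y z l₁) (satLit-majority x y z l₂) (atLeastTwo-pigeonhole hx hy hz)

⟦⟧-majorityClosed : (φ : List (Clause r)) → MajorityClosed ⟦ φ ⟧
⟦⟧-majorityClosed φ x y z φx φy φz =
  zipWith (λ {cl} ((hx , hy) , hz) → satClause-majority x y z cl hx hy hz) (zip (φx , φy) , φz)

bijunctive⇒majorityClosed : {R : Rel r} → BijunctiveRel R → MajorityClosed R
bijunctive⇒majorityClosed (φ , R⊆φ , φ⊆R) x y z Rx Ry Rz =
  φ⊆R (⟦⟧-majorityClosed φ x y z (R⊆φ Rx) (R⊆φ Ry) (R⊆φ Rz))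

module MajorityClosedWeights {m : ℕ} (S : NatSet) (closed : MajorityClosed (SymRel (2 + m) S)) where

  descend : a ≤ m → T (S a) → c ≤ m → T (S (1 + c)) → T (S c)
  descend a≤m Sa c≤m S1+c with pointOfWeight a≤m | pointOfWeight c≤m
  ... | u , refl | w , refl =
    subst (T ∘ S ∘ weight) (majority-xyy u w)
      (closed (false ∷ false ∷ u) (false ∷ true ∷ w) (true ∷ false ∷ w) Sa S1+c S1+c)

  ascend : b ≤ m → T (S (2 + b)) → c ≤ m → T (S (1 + c)) → T (S (2 + c))
  ascend b≤m S2+b c≤m S1+c with pointOfWeight b≤m | pointOfWeight c≤m
  ... | u , refl | w , refl =
    subst (λ v → T (S (2 + weight v))) (majority-xyy u w)
      (closed (true ∷ true ∷ u) (true ∷ false ∷ w) (false ∷ true ∷ w) S2+b S1+c S1+c)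

  descend* : a ≤ m → T (S a) → k ≤ 1 + m → T (S k) → j ≤′ k → T (S j)
  descend* a≤m Sa _         Sk ≤′-refl        = Sk
  descend* a≤m Sa (s≤s k≤m) Sk (≤′-step j≤′k) =
    descend* a≤m Sa (m≤n⇒m≤1+n k≤m) (descend a≤m Sa k≤m Sk) j≤′k

  ascend* : b ≤ m → T (S (2 + b)) → 1 ≤ k → T (S k) → k ≤′ j → j ≤ 2 + m → T (S j)
  ascend* b≤m S2+b 1≤k Sk ≤′-refl        _    = Sk
  ascend* b≤m S2+b 1≤k Sk (≤′-step k≤′j) 1+j≤ =
    step (≤-trans 1≤k (≤′⇒≤ k≤′j)) 1+j≤ (ascend* b≤m S2+b 1≤k Sk k≤′j (<⇒≤ 1+j≤))
    where
    step : ∀ {i} → 1 ≤ i → 1 + i ≤ 2 + m → T (S i) → T (S (1 + i))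
    step (s≤s z≤n) (s≤s (s≤s c≤m)) = ascend b≤m S2+b c≤m

  full-of : a ≤ m → T (S a) → b ≤ m → T (S (2 + b)) → c ≤ m → T (S (1 + c)) → Full (2 + m) S
  full-of {c = c} a≤m Sa b≤m S2+b c≤m S1+c k k≤2+m with ≤-total k (1 + c)
  ... | inj₁ k≤1+c = descend* a≤m Sa (s≤s c≤m) S1+c (≤⇒≤′ k≤1+c)
  ... | inj₂ 1+c≤k = ascend* b≤m S2+b (s≤s z≤n) S1+c (≤⇒≤′ 1+c≤k) k≤2+m

Classified : ℕ → NatSet → Set
Classified r S = Translates (SymRel r (S-≤1 r)) (SymRel r S)
               ⊎ Translates (SymRel r (S-AE r)) (SymRel r S)
               ⊎ Translates (SymRel r (S-AND r)) (SymRel r S)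

classified-reflect : (S : NatSet) → Classified r (reflect r S) → Classified r S
classified-reflect {r} S = Sum.map unreflect (Sum.map unreflect unreflect)
  where
  unreflect : ∀ {R} → Translates R (SymRel r (reflect r S)) → Translates R (SymRel r S)
  unreflect t = translates-trans t (translates-sym (reflect-translates S))

m≤n⇒¬T[m≡ᵇ1+n] : m ≤ n → ¬ T (m ≡ᵇ suc n)
m≤n⇒¬T[m≡ᵇ1+n] {m} {n} m≤n t = 1+n≰n (subst (_≤ n) (≡ᵇ⇒≡ m (suc n) t) m≤n)

data Position (n : ℕ) : ℕ → Set where
  first       : Position n 0
  second      : Position n 1
  middle      : j < n → Position n (2 + j)
  penultimate : Position n (2 + n)
  last        : Position n (3 + n)

position : k ≤ 3 + n → Position n k
position {zero}        _                  = first
position {suc zero}    _                  = second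
position {suc (suc j)} (s≤s (s≤s j≤1+n)) with m≤n⇒m<n∨m≡n j≤1+n
... | inj₂ refl       = last
... | inj₁ (s≤s j≤n) with m≤n⇒m<n∨m≡n j≤n
...   | inj₂ refl = penultimate
...   | inj₁ j<n  = middle j<n

module AtLeastThree {n : ℕ} {S : NatSet}
  (closed : MajorityClosed (SymRel (3 + n) S)) (¬full : ¬ Full (3 + n) S) where

  open MajorityClosedWeights S closed

  middle-absent : j < n → ¬ T (S (2 + j))
  middle-absent j<n S2+j =
    ¬full (full-of (s≤s j<n) S2+j (m≤n⇒m≤1+n (<⇒≤ j<n)) S2+j (s≤s (<⇒≤ j<n)) S2+j)

  agree-by-ends : T (S 0) → ¬ T (S (2 + n)) →
                  T (G 0) → (∀ {j} → j < n → ¬ T (G (2 + j))) → ¬ T (G (2 + n)) →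
                  (T (S 1) ⇔ T (G 1)) → (T (S (3 + n)) ⇔ T (G (3 + n))) → Agree (3 + n) S G
  agree-by-ends s₀ ¬s₂ g₀ ¬gₘ ¬g₂ s₁⇔g₁ s₃⇔g₃ k k≤ with position k≤
  ... | first       = ⇔-both s₀ g₀
  ... | second      = s₁⇔g₁
  ... | middle j<n  = ⇔-neither (middle-absent j<n) (¬gₘ j<n)
  ... | penultimate = ⇔-neither ¬s₂ ¬g₂
  ... | last        = s₃⇔g₃

  classify-with-0 : T (S 0) → Classified (3 + n) S
  classify-with-0 s₀ with T? (S 1) | T? (S (2 + n)) | T? (S (3 + n))
  ... | _      | yes s₂ | _      = ⊥-elim (¬full (full-of z≤n s₀ (n≤1+n n) s₂ ≤-refl s₂))
  ... | yes s₁ | no _   | yes s₃ = ⊥-elim (¬full (full-of z≤n s₀ ≤-refl s₃ z≤n s₁))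
  ... | yes s₁ | no ¬s₂ | no ¬s₃ = inj₁ (agree⇒translates S (S-≤1 (3 + n))
        (agree-by-ends s₀ ¬s₂ tt (λ _ ()) (λ ()) (⇔-both s₁ tt) (⇔-neither ¬s₃ λ ())))
  ... | no ¬s₁ | no ¬s₂ | yes s₃ = inj₂ (inj₁ (agree⇒translates S (S-AE (3 + n))
        (agree-by-ends s₀ ¬s₂ tt (m≤n⇒¬T[m≡ᵇ1+n] ∘ <⇒≤) (m≤n⇒¬T[m≡ᵇ1+n] {n} ≤-refl)
          (⇔-neither ¬s₁ λ ()) (⇔-both s₃ (≡⇒≡ᵇ n n refl)))))
  ... | no ¬s₁ | no ¬s₂ | no ¬s₃ = inj₂ (inj₂ (agree⇒translates S (S-AND (3 + n))
        (agree-by-ends s₀ ¬s₂ tt (λ _ ()) (λ ()) (⇔-neither ¬s₁ λ ()) (⇔-neither ¬s₃ λ ()))))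

  empty-without-ends : ¬ T (S 0) → ¬ T (S (3 + n)) → Empty (3 + n) S
  empty-without-ends ¬s₀ ¬s₃ k k≤ with position k≤
  ... | first       = ¬s₀
  ... | second      = λ s₁ → ¬s₀ (descend (s≤s z≤n) s₁ z≤n s₁)
  ... | middle j<n  = middle-absent j<n
  ... | penultimate = λ s₂ → ¬s₃ (ascend (n≤1+n n) s₂ ≤-refl s₂)
  ... | last        = ¬s₃

≤1-elim : {P : ℕ → Set} → P 0 → P 1 → ∀ k → k ≤ 1 → P k
≤1-elim p₀ _  0             _                = p₀
≤1-elim _  p₁ 1             _                = p₁
≤1-elim _  _  (suc (suc _)) (s≤s ())

≤2-elim : {P : ℕ → Set} → P 0 → P 1 → P 2 → ∀ k → k ≤ 2 → P k
≤2-elim p₀ _  _  0                   _ = p₀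
≤2-elim _  p₁ _  1                   _ = p₁
≤2-elim _  _  p₂ 2                   _ = p₂
≤2-elim _  _  _  (suc (suc (suc _))) (s≤s (s≤s ()))

classify-with-0 : ∀ r S → MajorityClosed (SymRel r S) → ¬ Full r S → T (S 0) → Classified r S
classify-with-0 0 S _ ¬full s₀ = ⊥-elim (¬full λ { 0 _ → s₀ ; (suc _) () })
classify-with-0 1 S _ ¬full s₀ with T? (S 1)
... | yes s₁ = ⊥-elim (¬full (≤1-elim s₀ s₁))
... | no ¬s₁ = inj₂ (inj₂ (agree⇒translates S (S-AND 1)
      (≤1-elim (⇔-both s₀ tt) (⇔-neither ¬s₁ λ ()))))
classify-with-0 2 S _ ¬full s₀ with T? (S 1) | T? (S 2)
... | yes s₁ | yes s₂ = ⊥-elim (¬full (≤2-elim s₀ s₁ s₂))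
... | yes s₁ | no ¬s₂ = inj₁ (agree⇒translates S (S-≤1 2)
      (≤2-elim (⇔-both s₀ tt) (⇔-both s₁ tt) (⇔-neither ¬s₂ λ ())))
... | no ¬s₁ | yes s₂ = inj₂ (inj₁ (agree⇒translates S (S-AE 2)
      (≤2-elim (⇔-both s₀ tt) (⇔-neither ¬s₁ λ ()) (⇔-both s₂ tt))))
... | no ¬s₁ | no ¬s₂ = inj₂ (inj₂ (agree⇒translates S (S-AND 2)
      (≤2-elim (⇔-both s₀ tt) (⇔-neither ¬s₁ λ ()) (⇔-neither ¬s₂ λ ()))))
classify-with-0 (suc (suc (suc n))) S closed ¬full = AtLeastThree.classify-with-0 closed ¬full

classify-without-ends : ∀ r S → MajorityClosed (SymRel r S) → ¬ Empty r S → ¬ Full r S →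
                        ¬ T (S 0) → ¬ T (S r) → Classified r S
classify-without-ends 0 S _ ¬empty _ ¬s₀ _   = ⊥-elim (¬empty λ { 0 _ → ¬s₀ ; (suc _) () })
classify-without-ends 1 S _ ¬empty _ ¬s₀ ¬s₁ = ⊥-elim (¬empty (≤1-elim ¬s₀ ¬s₁))
classify-without-ends 2 S _ ¬empty _ ¬s₀ ¬s₂ with T? (S 1)
... | no ¬s₁ = ⊥-elim (¬empty (≤2-elim ¬s₀ ¬s₁ ¬s₂))
... | yes s₁ = inj₂ (inj₁ (symRel-translates S (S-AE 2) (true ∷ false ∷ []) λ where
      (false ∷ false ∷ []) → ⇔-neither ¬s₀ λ ()
      (true  ∷ false ∷ []) → ⇔-both s₁ tt
      (false ∷ true  ∷ []) → ⇔-both s₁ tt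
      (true  ∷ true  ∷ []) → ⇔-neither ¬s₂ λ ()))
classify-without-ends (suc (suc (suc n))) S closed ¬empty ¬full ¬s₀ ¬s₃ =
  ⊥-elim (¬empty (AtLeastThree.empty-without-ends closed ¬full ¬s₀ ¬s₃))

classify : ∀ r S → MajorityClosed (SymRel r S) → MajorityClosed (SymRel r (reflect r S)) →
           ¬ Empty r S → ¬ Full r S → Classified r S
classify r S closed closedᵣ ¬empty ¬full with T? (S 0) | T? (S r)
... | yes s₀ | _      = classify-with-0 r S closed ¬full s₀
... | no _   | yes sᵣ =
  classified-reflect S (classify-with-0 r (reflect r S) closedᵣ (¬full ∘ reflect-full S) sᵣ)
... | no ¬s₀ | no ¬sᵣ = classify-without-ends r S closed ¬empty ¬full ¬s₀ ¬sᵣ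

mainTheorem19 : (r : ℕ) → 1 ≤ r → (S : NatSet) → (∀ k → T (S k) → k ≤ r) →
                ¬ Trivial (SymLangN r S) → Bijunctive (SymLangN r S) →
                (SymLangN r S ≈L ≤1-out-of-SAT r) ⊎ (SymLangN r S ≈L rAE r) ⊎ (SymLangN r S ≈L rAND r)
mainTheorem19 r _ S _ nontrivial bijunctive =
  Sum.map translates-≈L (Sum.map translates-≈L translates-≈L)
    (classify r S (closed (≐⇒translates ≐-refl)) (closed (reflect-translates S))
      (nontrivial ∘ empty⇒trivial S) (nontrivial ∘ full⇒trivial S))
  where
  closed : ∀ {R} → SymLangN r S R → MajorityClosed R
  closed R∈Γ = bijunctive⇒majorityClosed (bijunctive _ R∈Γ)
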